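{- Let $0<\varepsilon<1/6$ and let $H$ be a bipartite graph with $(1-\varepsilon)$-complete degree whose edges are coloured with two colours. Then (a) there are one or two $2\varepsilon$-non-trivial monochromatic components that together $(1-3\varepsilon)$-span $H$, and (b) if the colouring is not $2\varepsilon$-split, then there is a colour with exactly one $3\varepsilon$-non-trivial monochromatic component.
   Context: Let $H$ have biparts $A,B$. $H$ has $\gamma$-complete degree if every vertex of $B$ has more than $\gamma|A|$ neighbours and every vertex of $A$ has more than $\gamma|B|$ neighbours. A subgraph (or union of subgraphs) with biparts $X\subseteq A$, $Y\subseteq B$ is $\gamma$-non-trivial, equivalently $\gamma$-spans $H$, if $|X|\ge\gamma|A|$ and $|Y|\ge\gamma|B|$. A monochromatic component of colour $c$ is a connected component of the subgraph formed by edges of colour $c$. The colouring is $\varepsilon$-split if all monochromatic components are $\varepsilon$-non-trivial and each colour has exactly two monochromatic components.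
   Formalization: The parameter ε ranges over the rationals. -}

module Defs where

open import Data.Nat as ℕ using (ℕ)
open import Data.Integer using (+_)
open import Data.Fin using (Fin)
open import Data.Fin.Subset using (Subset; _∈_; ∣_∣; _∪_)
open import Data.Vec using (tabulate)
open import Data.Maybe using (Maybe; just; is-just)
open import Data.Sum using (_⊎_; inj₁; inj₂)
open import Data.Product using (Σ; _×_; _,_; ∃)
open import Data.Empty using (⊥)
open import Relation.Binary.PropositionalEquality using (_≡_)
open import Relation.Binary.Construct.Closure.ReflexiveTransitive using (Star)
open import Relation.Nullary using (¬_)
open import Function.Bundles using (_⇔_)
open import Data.Rational using (ℚ; _/_; _*_; _≤_; _<_)

Colour : Set
Colour = Fin 2

-- A 2-edge-coloured bipartite graph with biparts A = Fin m and B = Fin n: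
-- col a b = nothing  means  ab is not an edge,
-- col a b = just c   means  ab is an edge of colour c.
Coloured : ℕ → ℕ → Set
Coloured m n = Fin m → Fin n → Maybe Colour

Vertex : ℕ → ℕ → Set
Vertex m n = Fin m ⊎ Fin n

Adj : ∀ {m n} → Coloured m n → Colour → Vertex m n → Vertex m n → Set
Adj col c (inj₁ a) (inj₂ b) = col a b ≡ just c
Adj col c (inj₂ b) (inj₁ a) = col a b ≡ just c
Adj col c (inj₁ _) (inj₁ _) = ⊥
Adj col c (inj₂ _) (inj₂ _) = ⊥

Conn : ∀ {m n} → Coloured m n → Colour → Vertex m n → Vertex m n → Set
Conn col c = Star (Adj col c)

IsComp : ∀ {m n} → Coloured m n → Colour → Subset m → Subset n → Set
IsComp {m} {n} col c X Y =
  Σ (Vertex m n) λ v →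
    (∀ a → (a ∈ X) ⇔ Conn col c v (inj₁ a)) ×
    (∀ b → (b ∈ Y) ⇔ Conn col c v (inj₂ b))

ℕ→ℚ : ℕ → ℚ
ℕ→ℚ k = + k / 1

-- (X , Y) is γ-non-trivial / γ-spans H:  |X| ≥ γ|A| and |Y| ≥ γ|B|.
NonTrivial : ∀ {m n} → ℚ → Subset m → Subset n → Set
NonTrivial {m} {n} γ X Y = (γ * ℕ→ℚ m ≤ ℕ→ℚ ∣ X ∣) × (γ * ℕ→ℚ n ≤ ℕ→ℚ ∣ Y ∣)

nbrA : ∀ {m n} → Coloured m n → Fin m → Subset n
nbrA col a = tabulate (λ b → is-just (col a b))

nbrB : ∀ {m n} → Coloured m n → Fin n → Subset m
nbrB col b = tabulate (λ a → is-just (col a b))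

CompleteDegree : ∀ {m n} → ℚ → Coloured m n → Set
CompleteDegree {m} {n} γ col =
  (∀ b → γ * ℕ→ℚ m < ℕ→ℚ ∣ nbrB col b ∣) ×
  (∀ a → γ * ℕ→ℚ n < ℕ→ℚ ∣ nbrA col a ∣)

ExactlyTwoComps : ∀ {m n} → Coloured m n → Colour → Set
ExactlyTwoComps {m} {n} col c =
  Σ (Subset m) λ X₁ → Σ (Subset n) λ Y₁ → Σ (Subset m) λ X₂ → Σ (Subset n) λ Y₂ →
    IsComp col c X₁ Y₁ × IsComp col c X₂ Y₂ ×
    ¬ ((X₁ , Y₁) ≡ (X₂ , Y₂)) ×
    (∀ X Y → IsComp col c X Y → ((X , Y) ≡ (X₁ , Y₁)) ⊎ ((X , Y) ≡ (X₂ , Y₂)))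

Split : ∀ {m n} → ℚ → Coloured m n → Set
Split γ col =
  (∀ c X Y → IsComp col c X Y → NonTrivial γ X Y) ×
  (∀ c → ExactlyTwoComps col c)

ExactlyOneNonTrivial : ∀ {m n} → ℚ → Coloured m n → Colour → Set
ExactlyOneNonTrivial {m} {n} γ col c =
  Σ (Subset m) λ X₀ → Σ (Subset n) λ Y₀ →
    IsComp col c X₀ Y₀ × NonTrivial γ X₀ Y₀ ×
    (∀ X Y → IsComp col c X Y → NonTrivial γ X Y → (X , Y) ≡ (X₀ , Y₀))

-- Write (X, Y) = K(c, v) for the c-component of v.  Everything rests on a crossing lemma: if
-- |S| ≥ 2ε|A|, |T| ≥ ε|B| and all edges between S and T have colour d, then S ∪ T lies in one
-- d-component, since by the degree condition any two vertices of T have a common neighbour in S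
-- and each vertex of S has a neighbour in T.  No edge leaving K(c, v) has colour c, so the lemma
-- puts ∁X ∪ Y and X ∪ ∁Y into components of the other colour whenever ∁X, resp. ∁Y, is large.
--
-- (a) A large colour class at a vertex of A yields a 2ε-non-trivial K(c, v).  On each side it
-- either already (1-3ε)-spans, or the other-colour component of the complement covers the rest.
-- (b) The same case analysis yields a 3ε-non-trivial K(c, v).  If colour c has a second one,
-- K(c, w), the crossing lemma puts X ∪ Y₂ and X₂ ∪ Y into other-colour components K(c′, q₁) and
-- K(c′, q₂), which absorb all vertices outside X, resp. Y.  If q₁ and q₂ are connected, colour c′
-- has a single component; otherwise each colour has exactly two components, all 2ε-non-trivial,
-- so the colouring is 2ε-split.
module Submission where

open import Defs
open import Data.Nat using (ℕ)
open import Data.Integer using (+_)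
open import Data.Rational using (ℚ; _/_; _*_; _-_; _<_; 0ℚ; 1ℚ)
open import Data.Fin.Subset using (Subset; _∪_)
open import Data.Product using (Σ; _×_; ∃)
open import Relation.Nullary using (¬_)

open import Data.Bool.Base using (Bool; true)
open import Data.Empty using (⊥-elim)
open import Data.Fin.Base using (Fin; zero; suc; fromℕ<)
open import Data.Fin.Properties as Finₚ using (any?; +↔⊎)
open import Data.Fin.Subset using (_∈_; _∉_; _⊆_; _⊂_; ∁; _∩_; ⊤; ⁅_⁆; ∣_∣; inside; outside)
open import Data.Fin.Subset.Properties
open import Data.Integer.Base as ℤ using ()
import Data.Integer.Properties as ℤₚ
open import Data.Maybe.Base using (Maybe; just; is-just)
open import Data.Maybe.Properties using (≡-dec)
import Data.Nat.Base as ℕ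
import Data.Nat.Coprimality as Coprime
import Data.Nat.Properties as ℕₚ
open import Data.Product using (Σ-syntax; ∃₂; _,_; proj₁; proj₂)
open import Data.Rational.Base using (mkℚ; _+_; -_; _≤_; *≤*; NonNegative; nonNegative)
import Data.Rational.Properties as ℚₚ
open import Data.Rational.Solver using (module +-*-Solver)
open import Data.Sum.Base as Sum using (_⊎_; inj₁; inj₂; [_,_]′)
open import Data.Vec.Base using (_∷_; []; tabulate)
open import Data.Vec.Properties using (lookup∘tabulate; []=⇒lookup; lookup⇒[]=)
open import Function.Base using (_∘_; id)
open import Function.Bundles using (_↔_; Inverse; mk⇔; Equivalence)
open import Level using (Level)
open import Relation.Binary.Core using (Rel)
import Relation.Binary.Definitions as B
open import Relation.Binary.Construct.Closure.ReflexiveTransitive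
  using (Star; _◅_; _◅◅_; gmap; reverse) renaming (ε to refl⋆)
open import Relation.Binary.PropositionalEquality
  using (_≡_; _≢_; refl; sym; trans; cong; cong₂; subst; subst₂)
open import Relation.Nullary.Decidable
  using (Dec; yes; no; does; map′; toSum; _×-dec_; ¬?; decidable-stable; dec-true)
open import Relation.Nullary.Negation using (contradiction)
open import Relation.Unary using (Pred; Decidable)

private
  variable
    a ℓ : Level
    k m n N : ℕ
    γ δ : ℚ

-- Finite subsets

∈-tabulate⁻ : ∀ {f : Fin k → Bool} {x} → x ∈ tabulate f → f x ≡ true
∈-tabulate⁻ {f = f} {x} x∈ = trans (sym (lookup∘tabulate f x)) ([]=⇒lookup x∈)

module _ {P : Pred (Fin k) ℓ} (P? : Decidable P) where

  decSubset : Subset k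
  decSubset = tabulate (does ∘ P?)

  ∈-decSubset⁺ : ∀ {x} → P x → x ∈ decSubset
  ∈-decSubset⁺ {x} px = lookup⇒[]= x decSubset (trans (lookup∘tabulate _ x) (dec-true (P? x) px))

  ∈-decSubset⁻ : ∀ {x} → x ∈ decSubset → P x
  ∈-decSubset⁻ {x} x∈ with P? x | ∈-tabulate⁻ x∈
  ... | yes px | _  = px
  ... | no  _  | ()

∈⊎∈∁ : ∀ x (p : Subset k) → x ∈ p ⊎ x ∈ ∁ p
∈⊎∈∁ x p with x ∈? p
... | yes x∈p = inj₁ x∈p
... | no  x∉p = inj₂ (x∉p⇒x∈∁p x∉p)

∣p∪q∣≤∣p∣+∣q∣ : ∀ (p q : Subset k) → ∣ p ∪ q ∣ ℕ.≤ ∣ p ∣ ℕ.+ ∣ q ∣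
∣p∪q∣≤∣p∣+∣q∣ []            []            = ℕ.z≤n
∣p∪q∣≤∣p∣+∣q∣ (outside ∷ p) (outside ∷ q) = ∣p∪q∣≤∣p∣+∣q∣ p q
∣p∪q∣≤∣p∣+∣q∣ (outside ∷ p) (inside  ∷ q) =
  ℕₚ.≤-trans (ℕ.s≤s (∣p∪q∣≤∣p∣+∣q∣ p q)) (ℕₚ.≤-reflexive (sym (ℕₚ.+-suc ∣ p ∣ ∣ q ∣)))
∣p∪q∣≤∣p∣+∣q∣ (inside  ∷ p) (outside ∷ q) = ℕ.s≤s (∣p∪q∣≤∣p∣+∣q∣ p q)
∣p∪q∣≤∣p∣+∣q∣ (inside  ∷ p) (inside  ∷ q) =
  ℕ.s≤s (ℕₚ.≤-trans (∣p∪q∣≤∣p∣+∣q∣ p q) (ℕₚ.+-monoʳ-≤ ∣ p ∣ (ℕₚ.n≤1+n ∣ q ∣)))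

∣p∣+∣∁p∣≡n : ∀ (p : Subset k) → ∣ p ∣ ℕ.+ ∣ ∁ p ∣ ≡ k
∣p∣+∣∁p∣≡n p = trans (cong (∣ p ∣ ℕ.+_) (∣∁p∣≡n∸∣p∣ p)) (ℕₚ.m+[n∸m]≡n (∣p∣≤n p))

∣q∣<∣p∣⇒p⊈q : {p q : Subset k} → ∣ q ∣ ℕ.< ∣ p ∣ → ∃ λ x → x ∈ p × x ∉ q
∣q∣<∣p∣⇒p⊈q {p = p} {q} ∣q∣<∣p∣ with nonempty? (p ∩ ∁ q)
... | yes (x , x∈p∩∁q) = x , p∩q⊆p p (∁ q) x∈p∩∁q , x∈∁p⇒x∉p (p∩q⊆q p (∁ q) x∈p∩∁q)
... | no  p∩∁q-empty  = contradiction (p⊆q⇒∣p∣≤∣q∣ p⊆q) (ℕₚ.<⇒≱ ∣q∣<∣p∣)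
  where
  p⊆q : p ⊆ q
  p⊆q {x} x∈p = decidable-stable (x ∈? q) (λ x∉q → p∩∁q-empty (x , x∈p∩q⁺ (x∈p , x∉p⇒x∈∁p x∉q)))

p⊆r∧∁p⊆r⇒∣r∣≡n : {p r : Subset k} → p ⊆ r → ∁ p ⊆ r → ∣ r ∣ ≡ k
p⊆r∧∁p⊆r⇒∣r∣≡n {p = p} {r} p⊆r ∁p⊆r = trans (cong ∣_∣ (⊆-antisym ⊆⊤ ⊤⊆r)) (∣⊤∣≡n _)
  where
  ⊤⊆r : ⊤ ⊆ r
  ⊤⊆r {x} _ = [ p⊆r , ∁p⊆r ]′ (∈⊎∈∁ x p)

p⊆q∧p⊄q⇒q⊆p : {p q : Subset k} → p ⊆ q → ¬ (p ⊂ q) → q ⊆ p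
p⊆q∧p⊄q⇒q⊆p {p = p} p⊆q p⊄q {x} x∈q = decidable-stable (x ∈? p) (λ x∉p → p⊄q (p⊆q , x , x∈q , x∉p))

-- Reachability in a finite decidable graph

module Reachability {R : Rel (Fin k) ℓ} (R? : B.Decidable R) where

  has-predecessor-in? : ∀ S → Decidable (λ y → ∃ λ x → x ∈ S × R x y)
  has-predecessor-in? S y = any? (λ x → x ∈? S ×-dec R? x y)

  grow : Subset k → Subset k
  grow S = S ∪ decSubset (has-predecessor-in? S)

  Closed : Subset k → Set ℓ
  Closed S = ∀ {x y} → x ∈ S → R x y → y ∈ S

  Star-closed : ∀ {S x y} → Closed S → x ∈ S → Star R x y → y ∈ S
  Star-closed closed x∈S refl⋆      = x∈S
  Star-closed closed x∈S (r ◅ path) = Star-closed closed (closed x∈S r) path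

  ReachedFrom : Subset k → Subset k → Set ℓ
  ReachedFrom S C = ∀ {y} → y ∈ C → ∃ λ x → x ∈ S × Star R x y

  grow-reached : ∀ S → ReachedFrom S (grow S)
  grow-reached S {y} y∈ with x∈p∪q⁻ S _ y∈
  ... | inj₁ y∈S = y , y∈S , refl⋆
  ... | inj₂ y∈successors =
    let x , x∈S , r = ∈-decSubset⁻ (has-predecessor-in? S) y∈successors in x , x∈S , r ◅ refl⋆

  -- Each call with S ⊂ grow S makes S strictly larger, so fuel k - ∣ S ∣ suffices.
  closure : ∀ fuel S → k ℕ.≤ ∣ S ∣ ℕ.+ fuel → Σ[ C ∈ Subset k ] S ⊆ C × Closed C × ReachedFrom S C
  closure fuel S bound with S ⊂? grow S
  ... | no S⊄ = S , id , closed , λ {y} y∈S → y , y∈S , refl⋆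
    where
    closed : Closed S
    closed x∈S r = p⊆q∧p⊄q⇒q⊆p (p⊆p∪q _) S⊄ (q⊆p∪q S _ (∈-decSubset⁺ (has-predecessor-in? S) (_ , x∈S , r)))
  closure ℕ.zero S bound | yes S⊂ =
    ⊥-elim (ℕₚ.<⇒≱ (p⊂q⇒∣p∣<∣q∣ S⊂)
                    (ℕₚ.≤-trans (∣p∣≤n (grow S)) (ℕₚ.≤-trans bound (ℕₚ.≤-reflexive (ℕₚ.+-identityʳ ∣ S ∣)))))
  closure (ℕ.suc fuel) S bound | yes S⊂ =
    let C , grow⊆C , closed , reached = closure fuel (grow S) bound′
    in C , grow⊆C ∘ p⊆p∪q _ , closed , reached-from-S reached
    where
    bound′ : k ℕ.≤ ∣ grow S ∣ ℕ.+ fuel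
    bound′ = ℕₚ.≤-trans bound (ℕₚ.≤-trans (ℕₚ.≤-reflexive (ℕₚ.+-suc ∣ S ∣ fuel))
                                           (ℕₚ.+-monoˡ-≤ fuel (p⊂q⇒∣p∣<∣q∣ S⊂)))
    reached-from-S : ∀ {C} → ReachedFrom (grow S) C → ReachedFrom S C
    reached-from-S reached y∈C =
      let x , x∈ , path = reached y∈C
          z , z∈S , path′ = grow-reached S x∈
      in z , z∈S , path′ ◅◅ path

  Star? : B.Decidable (Star R)
  Star? x y =
    let C , x⊆C , closed , reached = closure k ⁅ x ⁆ (ℕₚ.m≤n+m k ∣ ⁅ x ⁆ ∣)
        reached-from-x : y ∈ C → Star R x y
        reached-from-x y∈C =
          let z , z∈⁅x⁆ , path = reached y∈C in subst (λ z → Star R z y) (x∈⁅y⁆⇒x≡y x z∈⁅x⁆) path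
    in map′ reached-from-x (Star-closed closed (x⊆C (x∈⁅x⁆ x))) (y ∈? C)

Star-finite? : ∀ {A : Set a} {R : Rel A ℓ} → Fin k ↔ A → B.Decidable R → B.Decidable (Star R)
Star-finite? {R = R} enum R? x y =
  map′ from-Fin to-Fin (Reachability.Star? (λ i j → R? (to i) (to j)) (from x) (from y))
  where
  open Inverse enum
  from-Fin : Star (λ i j → R (to i) (to j)) (from x) (from y) → Star R x y
  from-Fin path = subst₂ (Star R) (strictlyInverseˡ x) (strictlyInverseˡ y) (gmap to id path)
  to-Fin : Star R x y → Star (λ i j → R (to i) (to j)) (from x) (from y)
  to-Fin = gmap from (λ {u} {v} r → subst₂ R (sym (strictlyInverseˡ u)) (sym (strictlyInverseˡ v)) r)

VertexSet : ℕ → ℕ → Set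
VertexSet m n = Subset m × Subset n

_∈ᵥ_ : Vertex m n → VertexSet m n → Set
inj₁ a ∈ᵥ K = a ∈ proj₁ K
inj₂ b ∈ᵥ K = b ∈ proj₂ K

_⊆ᵥ_ : VertexSet m n → VertexSet m n → Set
K ⊆ᵥ L = proj₁ K ⊆ proj₁ L × proj₂ K ⊆ proj₂ L

_∪ᵥ_ : VertexSet m n → VertexSet m n → VertexSet m n
K ∪ᵥ L = proj₁ K ∪ proj₁ L , proj₂ K ∪ proj₂ L

⊆ᵥ-antisym : {K L : VertexSet m n} → K ⊆ᵥ L → L ⊆ᵥ K → K ≡ L
⊆ᵥ-antisym (A⊆ , B⊆) (A⊇ , B⊇) = cong₂ _,_ (⊆-antisym A⊆ A⊇) (⊆-antisym B⊆ B⊇)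

∃-vertex? : {P : Vertex m n → Set ℓ} → Decidable P → Dec (∃ P)
∃-vertex? P? with any? (P? ∘ inj₁) | any? (P? ∘ inj₂)
... | yes (a , p) | _           = yes (inj₁ a , p)
... | no _        | yes (b , p) = yes (inj₂ b , p)
... | no ¬A       | no ¬B       = no λ { (inj₁ a , p) → ¬A (a , p) ; (inj₂ b , p) → ¬B (b , p) }

other : Colour → Colour
other zero       = suc zero
other (suc zero) = zero

other-involutive : ∀ c → other (other c) ≡ c
other-involutive zero       = refl
other-involutive (suc zero) = refl

≢⇒≡other : ∀ {x c : Colour} → x ≢ c → x ≡ other c
≢⇒≡other {zero}     {zero}     x≢c = contradiction refl x≢c
≢⇒≡other {zero}     {suc zero} x≢c = refl
≢⇒≡other {suc zero} {zero}     x≢c = refl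
≢⇒≡other {suc zero} {suc zero} x≢c = contradiction refl x≢c

∀-colour : ∀ {P : Colour → Set ℓ} c → P c → P (other c) → ∀ x → P x
∀-colour zero       p p′ zero       = p
∀-colour zero       p p′ (suc zero) = p′
∀-colour (suc zero) p p′ zero       = p′
∀-colour (suc zero) p p′ (suc zero) = p

-- Monochromatic components

module Components (col : Coloured m n) where

  Adj? : ∀ c → B.Decidable (Adj col c)
  Adj? c (inj₁ a) (inj₂ b) = ≡-dec Finₚ._≟_ (col a b) (just c)
  Adj? c (inj₂ b) (inj₁ a) = ≡-dec Finₚ._≟_ (col a b) (just c)
  Adj? c (inj₁ _) (inj₁ _) = no λ ()
  Adj? c (inj₂ _) (inj₂ _) = no λ ()

  Conn? : ∀ c → B.Decidable (Conn col c)
  Conn? c = Star-finite? +↔⊎ (Adj? c)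

  Adj-sym : ∀ {c} → B.Sym (Adj col c) (Adj col c)
  Adj-sym {x = inj₁ _} {inj₂ _} e = e
  Adj-sym {x = inj₂ _} {inj₁ _} e = e

  Conn-sym : ∀ {c} → B.Sym (Conn col c) (Conn col c)
  Conn-sym = reverse Adj-sym

  edge : ∀ {c a b} → col a b ≡ just c → Conn col c (inj₁ a) (inj₂ b)
  edge e = e ◅ refl⋆

  -- Opaque so that unification never unfolds the decision procedure behind it.
  opaque
    component : Colour → Vertex m n → VertexSet m n
    component c v = decSubset (λ a → Conn? c v (inj₁ a)) , decSubset (λ b → Conn? c v (inj₂ b))

    ∈component⁺ : ∀ c v {w} → Conn col c v w → w ∈ᵥ component c v
    ∈component⁺ c v {inj₁ a} = ∈-decSubset⁺ (λ a → Conn? c v (inj₁ a))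
    ∈component⁺ c v {inj₂ b} = ∈-decSubset⁺ (λ b → Conn? c v (inj₂ b))

    ∈component⁻ : ∀ c v {w} → w ∈ᵥ component c v → Conn col c v w
    ∈component⁻ c v {inj₁ a} = ∈-decSubset⁻ (λ a → Conn? c v (inj₁ a))
    ∈component⁻ c v {inj₂ b} = ∈-decSubset⁻ (λ b → Conn? c v (inj₂ b))

  Xof : Colour → Vertex m n → Subset m
  Xof c v = proj₁ (component c v)

  Yof : Colour → Vertex m n → Subset n
  Yof c v = proj₂ (component c v)

  component-IsComp : ∀ c v → IsComp col c (Xof c v) (Yof c v)
  component-IsComp c v =
    v , (λ a → mk⇔ (∈component⁻ c v) (∈component⁺ c v)) , (λ b → mk⇔ (∈component⁻ c v) (∈component⁺ c v))

  IsComp⇒component : ∀ {c X Y} → IsComp col c X Y → ∃ λ v → (X , Y) ≡ component c v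
  IsComp⇒component {c} (v , X⇔ , Y⇔) = v , ⊆ᵥ-antisym
    ( (λ {a} a∈X → ∈component⁺ c v {inj₁ a} (Equivalence.to (X⇔ a) a∈X))
    , (λ {b} b∈Y → ∈component⁺ c v {inj₂ b} (Equivalence.to (Y⇔ b) b∈Y)) )
    ( (λ {a} a∈K → Equivalence.from (X⇔ a) (∈component⁻ c v {inj₁ a} a∈K))
    , (λ {b} b∈K → Equivalence.from (Y⇔ b) (∈component⁻ c v {inj₂ b} b∈K)) )

  component-⊆ : ∀ {c u w} → Conn col c u w → component c w ⊆ᵥ component c u
  component-⊆ {c} {u} {w} u~w =
    (λ {a} a∈ → ∈component⁺ c u {inj₁ a} (u~w ◅◅ ∈component⁻ c w a∈)) ,
    (λ {b} b∈ → ∈component⁺ c u {inj₂ b} (u~w ◅◅ ∈component⁻ c w b∈))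

  component-cong : ∀ {c u w} → Conn col c u w → component c u ≡ component c w
  component-cong u~w = ⊆ᵥ-antisym (component-⊆ (Conn-sym u~w)) (component-⊆ u~w)

  component-injective : ∀ {c u} w → component c u ≡ component c w → Conn col c u w
  component-injective {c} {u} w K≡ =
    ∈component⁻ c u (subst (λ K → w ∈ᵥ K) (sym K≡) (∈component⁺ c w refl⋆))

  components-covered : ∀ {c v₁ v₂} → (∀ w → Conn col c v₁ w ⊎ Conn col c v₂ w) →
    ∀ {X Y} → IsComp col c X Y → (X , Y) ≡ component c v₁ ⊎ (X , Y) ≡ component c v₂
  components-covered cover isComp =
    let v , XY≡ = IsComp⇒component isComp
    in Sum.map (λ v₁~v → trans XY≡ (sym (component-cong v₁~v))) (λ v₂~v → trans XY≡ (sym (component-cong v₂~v)))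
               (cover v)

  exactlyTwoComps : ∀ {c v₁ v₂} → (∀ w → Conn col c v₁ w ⊎ Conn col c v₂ w) → ¬ Conn col c v₁ v₂ →
                    ExactlyTwoComps col c
  exactlyTwoComps {c} {v₁} {v₂} cover v₁≁v₂ =
    Xof c v₁ , Yof c v₁ , Xof c v₂ , Yof c v₂ , component-IsComp c v₁ , component-IsComp c v₂ ,
    v₁≁v₂ ∘ component-injective v₂ , λ X Y → components-covered cover

  unique-component : ∀ {c v} → (∀ w → Conn col c v w) → ∀ {X Y} → IsComp col c X Y → (X , Y) ≡ component c v
  unique-component cover isComp =
    let w , XY≡ = IsComp⇒component isComp in trans XY≡ (sym (component-cong (cover w)))

  ColouredBetween : Colour → Subset m → Subset n → Set
  ColouredBetween d S T = ∀ {a b x} → a ∈ S → b ∈ T → col a b ≡ just x → x ≡ d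

  ColouredBetween-mono : ∀ {d S S′ T T′} → S′ ⊆ S → T′ ⊆ T → ColouredBetween d S T → ColouredBetween d S′ T′
  ColouredBetween-mono S′⊆S T′⊆T coloured a∈ b∈ = coloured (S′⊆S a∈) (T′⊆T b∈)

  avoiding⇒ColouredBetween-other : ∀ {c S T} → (∀ {a b} → a ∈ S → b ∈ T → col a b ≢ just c) →
                                   ColouredBetween (other c) S T
  avoiding⇒ColouredBetween-other no-c a∈S b∈T e = ≢⇒≡other (λ x≡c → no-c a∈S b∈T (trans e (cong just x≡c)))

  leavingᴬ-coloured : ∀ {c v} → ColouredBetween (other c) (∁ (Xof c v)) (Yof c v)
  leavingᴬ-coloured {c} {v} = avoiding⇒ColouredBetween-other λ a∈∁X b∈Y e →
    x∈∁p⇒x∉p a∈∁X (∈component⁺ c v (∈component⁻ c v b∈Y ◅◅ Conn-sym (edge e)))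

  leavingᴮ-coloured : ∀ {c v} → ColouredBetween (other c) (Xof c v) (∁ (Yof c v))
  leavingᴮ-coloured {c} {v} = avoiding⇒ColouredBetween-other λ a∈X b∈∁Y e →
    x∈∁p⇒x∉p b∈∁Y (∈component⁺ c v (∈component⁻ c v a∈X ◅◅ edge e))

  between-coloured : ∀ {c v w} → ¬ Conn col c v w → ColouredBetween (other c) (Xof c v) (Yof c w)
  between-coloured {c} {v} {w} v≁w = avoiding⇒ColouredBetween-other λ a∈ b∈ e →
    v≁w (∈component⁻ c v a∈ ◅◅ edge e ◅◅ Conn-sym (∈component⁻ c w b∈))

-- Fractions of a finite set

ℕ→ℚ≡mkℚ : ∀ k → ℕ→ℚ k ≡ mkℚ (+ k) 0 (Coprime.sym (Coprime.1-coprimeTo k))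
ℕ→ℚ≡mkℚ k = ℚₚ.normalize-coprime (Coprime.sym (Coprime.1-coprimeTo k))

ℕ→ℚ-mono-≤ : ∀ {k l} → k ℕ.≤ l → ℕ→ℚ k ≤ ℕ→ℚ l
ℕ→ℚ-mono-≤ {k} {l} k≤l rewrite ℕ→ℚ≡mkℚ k | ℕ→ℚ≡mkℚ l =
  *≤* (subst₂ ℤ._≤_ (sym (ℤₚ.*-identityʳ (+ k))) (sym (ℤₚ.*-identityʳ (+ l))) (ℤ.+≤+ k≤l))

ℕ→ℚ-cancel-< : ∀ {k l} → ℕ→ℚ k < ℕ→ℚ l → k ℕ.< l
ℕ→ℚ-cancel-< {k} {l} k<l rewrite ℕ→ℚ≡mkℚ k | ℕ→ℚ≡mkℚ l =
  ℤₚ.drop‿+<+ (subst₂ ℤ._<_ (ℤₚ.*-identityʳ (+ k)) (ℤₚ.*-identityʳ (+ l)) (ℚₚ.drop-*<* k<l))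

ℕ→ℚ-+ : ∀ k l → ℕ→ℚ (k ℕ.+ l) ≡ ℕ→ℚ k + ℕ→ℚ l
ℕ→ℚ-+ k l rewrite ℕ→ℚ≡mkℚ k | ℕ→ℚ≡mkℚ l =
  cong (_/ 1) (sym (cong₂ ℤ._+_ (ℤₚ.*-identityʳ (+ k)) (ℤₚ.*-identityʳ (+ l))))

0≤ℕ→ℚ : ∀ k → 0ℚ ≤ ℕ→ℚ k
0≤ℕ→ℚ k = ℕ→ℚ-mono-≤ {0} {k} ℕ.z≤n

split-< : ∀ {x y z p q : ℚ} → x + y ≡ z → p + q ≡ z → x < p → q < y
split-< {x} {y} {z} {p} {q} x+y≡z p+q≡z x<p with q ℚₚ.<? y
... | yes q<y = q<y
... | no  q≮y = contradiction (trans x+y≡z (sym p+q≡z)) (ℚₚ.<⇒≢ (ℚₚ.+-mono-<-≤ x<p (ℚₚ.≮⇒≥ q≮y)))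

-- Records, not bare inequalities between ℕ→ℚ terms, so that N and k can be inferred.
record AtLeast (γ : ℚ) (N k : ℕ) : Set where
  constructor atLeast
  field ≤ℕ→ℚ : γ * ℕ→ℚ N ≤ ℕ→ℚ k

record Below (γ : ℚ) (N k : ℕ) : Set where
  constructor below
  field ℕ→ℚ< : ℕ→ℚ k < γ * ℕ→ℚ N

AtLeast? : ∀ γ N k → Dec (AtLeast γ N k)
AtLeast? γ N k = map′ atLeast AtLeast.≤ℕ→ℚ (γ * ℕ→ℚ N ℚₚ.≤? ℕ→ℚ k)

atLeast⊎below : ∀ γ N k → AtLeast γ N k ⊎ Below γ N k
atLeast⊎below γ N k with AtLeast? γ N k
... | yes γN≤k = inj₁ γN≤k
... | no  γN≰k = inj₂ (below (ℚₚ.≰⇒> (γN≰k ∘ atLeast)))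

AtLeast-mono : ∀ {k l} → k ℕ.≤ l → AtLeast γ N k → AtLeast γ N l
AtLeast-mono {l = l} k≤l (atLeast γN≤k) = atLeast (ℚₚ.≤-trans γN≤k (ℕ→ℚ-mono-≤ {l = l} k≤l))

AtLeast-antitone : ∀ {k} → δ ≤ γ → AtLeast γ N k → AtLeast δ N k
AtLeast-antitone {N = N} δ≤γ (atLeast γN≤k) =
  atLeast (ℚₚ.≤-trans (ℚₚ.*-monoʳ-≤-nonNeg (ℕ→ℚ N) {{nonNegative (0≤ℕ→ℚ N)}} δ≤γ) γN≤k)

AtLeast-all : γ ≤ 1ℚ → AtLeast γ N N
AtLeast-all {N = N} γ≤1 = atLeast (ℚₚ.≤-trans (ℚₚ.*-monoʳ-≤-nonNeg (ℕ→ℚ N) {{nonNegative (0≤ℕ→ℚ N)}} γ≤1)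
                                               (ℚₚ.≤-reflexive (ℚₚ.*-identityˡ (ℕ→ℚ N))))

Below-+ : ∀ {k l} → Below γ N k → Below δ N l → Below (γ + δ) N (k ℕ.+ l)
Below-+ {γ} {N} {δ} {k} {l} (below k<γN) (below l<δN) = below (begin-strict
  ℕ→ℚ (k ℕ.+ l)          ≡⟨ ℕ→ℚ-+ k l ⟩
  ℕ→ℚ k + ℕ→ℚ l          <⟨ ℚₚ.+-mono-< k<γN l<δN ⟩
  γ * ℕ→ℚ N + δ * ℕ→ℚ N  ≡⟨ ℚₚ.*-distribʳ-+ (ℕ→ℚ N) γ δ ⟨
  (γ + δ) * ℕ→ℚ N        ∎)
  where open ℚₚ.≤-Reasoning

Below-AtLeast⇒< : ∀ {k l} → Below γ N k → AtLeast γ N l → k ℕ.< l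
Below-AtLeast⇒< (below k<γN) (atLeast γN≤l) = ℕ→ℚ-cancel-< (ℚₚ.<-≤-trans k<γN γN≤l)

γx+[1-γ]x≡x : ∀ γ x → γ * x + (1ℚ - γ) * x ≡ x
γx+[1-γ]x≡x = solve 2 (λ γ x → γ :* x :+ (con 1ℚ :- γ) :* x := x) refl
  where open +-*-Solver

Below⇒AtLeast-complement : ∀ {k l} → k ℕ.+ l ≡ N → Below γ N k → AtLeast (1ℚ - γ) N l
Below⇒AtLeast-complement {N} {γ} {k} {l} k+l≡N (below k<γN) = atLeast (ℚₚ.<⇒≤
  (split-< (trans (sym (ℕ→ℚ-+ k l)) (cong ℕ→ℚ k+l≡N)) (γx+[1-γ]x≡x γ (ℕ→ℚ N)) k<γN))

Above⇒Below-complement : ∀ {k l} → k ℕ.+ l ≡ N → (1ℚ - γ) * ℕ→ℚ N < ℕ→ℚ k → Below γ N l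
Above⇒Below-complement {N} {γ} {k} {l} k+l≡N [1-γ]N<k = below (split-<
  (trans (ℚₚ.+-comm ((1ℚ - γ) * ℕ→ℚ N) (γ * ℕ→ℚ N)) (γx+[1-γ]x≡x γ (ℕ→ℚ N)))
  (trans (sym (ℕ→ℚ-+ k l)) (cong ℕ→ℚ k+l≡N)) [1-γ]N<k)

∁-large : γ ≤ 1ℚ - γ → (p : Subset k) → Below γ k ∣ p ∣ → AtLeast γ k ∣ ∁ p ∣
∁-large γ≤1-γ p p-small = AtLeast-antitone γ≤1-γ (Below⇒AtLeast-complement (∣p∣+∣∁p∣≡n p) p-small)

∁-small⇒large : (p : Subset k) → Below γ k ∣ ∁ p ∣ → AtLeast (1ℚ - γ) k ∣ p ∣
∁-small⇒large p ∁p-small =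
  Below⇒AtLeast-complement (trans (ℕₚ.+-comm ∣ ∁ p ∣ ∣ p ∣) (∣p∣+∣∁p∣≡n p)) ∁p-small

meets : {P T : Subset k} → Below γ N ∣ ∁ P ∣ → AtLeast γ N ∣ T ∣ → ∃ λ x → x ∈ T × x ∈ P
meets ∁P-small T-large =
  let x , x∈T , x∉∁P = ∣q∣<∣p∣⇒p⊈q (Below-AtLeast⇒< ∁P-small T-large) in x , x∈T , x∉∁p⇒x∈p x∉∁P

meets₂ : {P Q T : Subset k} → Below γ N ∣ ∁ P ∣ → Below δ N ∣ ∁ Q ∣ → AtLeast (γ + δ) N ∣ T ∣ →
         ∃ λ x → x ∈ T × x ∈ P × x ∈ Q
meets₂ {P = P} {Q} ∁P-small ∁Q-small T-large =
  let x , x∈T , x∉∁P∪∁Q = ∣q∣<∣p∣⇒p⊈q (ℕₚ.≤-<-trans (∣p∪q∣≤∣p∣+∣q∣ (∁ P) (∁ Q))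
                                                  (Below-AtLeast⇒< (Below-+ ∁P-small ∁Q-small) T-large))
  in x , x∈T , x∉∁p⇒x∈p (x∉∁P∪∁Q ∘ p⊆p∪q (∁ Q)) , x∉∁p⇒x∈p (x∉∁P∪∁Q ∘ q⊆p∪q (∁ P) (∁ Q))

Large : ℚ → VertexSet m n → Set
Large {m} {n} γ K = AtLeast γ m ∣ proj₁ K ∣ × AtLeast γ n ∣ proj₂ K ∣

Large? : ∀ γ (K : VertexSet m n) → Dec (Large γ K)
Large? {m} {n} γ K = AtLeast? γ m ∣ proj₁ K ∣ ×-dec AtLeast? γ n ∣ proj₂ K ∣

Large-mono : {K L : VertexSet m n} → K ⊆ᵥ L → Large γ K → Large γ L
Large-mono (A⊆ , B⊆) (A-large , B-large) =
  AtLeast-mono (p⊆q⇒∣p∣≤∣q∣ A⊆) A-large , AtLeast-mono (p⊆q⇒∣p∣≤∣q∣ B⊆) B-large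

Large-antitone : {K : VertexSet m n} → δ ≤ γ → Large γ K → Large δ K
Large-antitone δ≤γ (A-large , B-large) = AtLeast-antitone δ≤γ A-large , AtLeast-antitone δ≤γ B-large

Large⇒NonTrivial : {K : VertexSet m n} → Large γ K → NonTrivial γ (proj₁ K) (proj₂ K)
Large⇒NonTrivial (atLeast A-large , atLeast B-large) = A-large , B-large

NonTrivial⇒Large : {X : Subset m} {Y : Subset n} → NonTrivial γ X Y → Large γ (X , Y)
NonTrivial⇒Large (A-large , B-large) = atLeast A-large , atLeast B-large

≤-by-slack : ∀ {p q} r → 0ℚ ≤ r → q ≡ p + r → p ≤ q
≤-by-slack {p} {q} r 0≤r q≡p+r = begin
  p       ≡⟨ ℚₚ.+-identityʳ p ⟨
  p + 0ℚ  ≤⟨ ℚₚ.+-monoʳ-≤ p 0≤r ⟩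
  p + r   ≡⟨ q≡p+r ⟨
  q       ∎
  where open ℚₚ.≤-Reasoning

module SmallParameter (ε : ℚ) (0<ε : 0ℚ < ε) (ε<1/6 : ε < + 1 / 6) where

  2ε 3ε : ℚ
  2ε = + 2 / 1 * ε
  3ε = + 3 / 1 * ε

  private
    open +-*-Solver

    0≤1/6-ε : 0ℚ ≤ + 1 / 6 - ε
    0≤1/6-ε = ℚₚ.≤-trans (ℚₚ.≤-reflexive (sym (ℚₚ.+-inverseʳ ε))) (ℚₚ.+-monoˡ-≤ (- ε) (ℚₚ.<⇒≤ ε<1/6))

    0≤-scale : ∀ {s} α .{{_ : NonNegative α}} → 0ℚ ≤ s → 0ℚ ≤ α * s
    0≤-scale α 0≤s = ℚₚ.≤-trans (ℚₚ.≤-reflexive (sym (ℚₚ.*-zeroʳ α))) (ℚₚ.*-monoˡ-≤-nonNeg α 0≤s)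

    -- Each bound q ≥ p below has q - p = α (1/6 - ε) + β ε with constants α, β ≥ 0.
    slack : ∀ α β .{{_ : NonNegative α}} .{{_ : NonNegative β}} → 0ℚ ≤ α * (+ 1 / 6 - ε) + β * ε
    slack α β = ℚₚ.+-mono-≤ (0≤-scale α 0≤1/6-ε) (0≤-scale β (ℚₚ.<⇒≤ 0<ε))

  ε≤2ε : ε ≤ 2ε
  ε≤2ε = ≤-by-slack _ (slack 0ℚ 1ℚ) (solve 1 (λ e →
    con (+ 2 / 1) :* e := e :+ (con 0ℚ :* (con (+ 1 / 6) :- e) :+ con 1ℚ :* e)) refl ε)

  2ε≤3ε : 2ε ≤ 3ε
  2ε≤3ε = ≤-by-slack _ (slack 0ℚ 1ℚ) (solve 1 (λ e →
    con (+ 3 / 1) :* e := con (+ 2 / 1) :* e :+ (con 0ℚ :* (con (+ 1 / 6) :- e) :+ con 1ℚ :* e)) refl ε)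

  ε≤3ε : ε ≤ 3ε
  ε≤3ε = ℚₚ.≤-trans ε≤2ε 2ε≤3ε

  ε+ε≤2ε : ε + ε ≤ 2ε
  ε+ε≤2ε = ℚₚ.≤-reflexive (solve 1 (λ e → e :+ e := con (+ 2 / 1) :* e) refl ε)

  2ε≤1-2ε : 2ε ≤ 1ℚ - 2ε
  2ε≤1-2ε = ≤-by-slack _ (slack (+ 6 / 1) (+ 2 / 1)) (solve 1 (λ e →
    con 1ℚ :- con (+ 2 / 1) :* e
      := con (+ 2 / 1) :* e :+ (con (+ 6 / 1) :* (con (+ 1 / 6) :- e) :+ con (+ 2 / 1) :* e)) refl ε)

  3ε≤1-3ε : 3ε ≤ 1ℚ - 3ε
  3ε≤1-3ε = ≤-by-slack _ (slack (+ 6 / 1) 0ℚ) (solve 1 (λ e →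
    con 1ℚ :- con (+ 3 / 1) :* e
      := con (+ 3 / 1) :* e :+ (con (+ 6 / 1) :* (con (+ 1 / 6) :- e) :+ con 0ℚ :* e)) refl ε)

  1-3ε≤1 : 1ℚ - 3ε ≤ 1ℚ
  1-3ε≤1 = ≤-by-slack _ (slack 0ℚ (+ 3 / 1)) (solve 1 (λ e →
    con 1ℚ := con 1ℚ :- con (+ 3 / 1) :* e :+ (con 0ℚ :* (con (+ 1 / 6) :- e) :+ con (+ 3 / 1) :* e)) refl ε)

  2ε+2ε+ε≤1 : 2ε + 2ε + ε ≤ 1ℚ
  2ε+2ε+ε≤1 = ≤-by-slack _ (slack (+ 6 / 1) 1ℚ) (solve 1 (λ e →
    con 1ℚ := con (+ 2 / 1) :* e :+ con (+ 2 / 1) :* e :+ e :+ (con (+ 6 / 1) :* (con (+ 1 / 6) :- e) :+ con 1ℚ :* e))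
    refl ε)

-- Graphs of (1 - ε)-complete degree

just-if-is-just : ∀ {A : Set} (mx : Maybe A) → is-just mx ≡ true → ∃ λ x → mx ≡ just x
just-if-is-just (just x) _ = x , refl

module Dense {m n} (col : Coloured m n) (ε : ℚ) (deg : CompleteDegree (1ℚ - ε) col) where

  open Components col

  Edge : Fin m → Fin n → Set
  Edge a b = ∃ λ x → col a b ≡ just x

  ∈nbrA⇒Edge : ∀ {a b} → b ∈ nbrA col a → Edge a b
  ∈nbrA⇒Edge {a} {b} b∈ = just-if-is-just (col a b) (∈-tabulate⁻ b∈)

  ∈nbrB⇒Edge : ∀ {a b} → a ∈ nbrB col b → Edge a b
  ∈nbrB⇒Edge {a} {b} a∈ = just-if-is-just (col a b) (∈-tabulate⁻ a∈)

  coloured-edge : ∀ {d S T a b} → ColouredBetween d S T → a ∈ S → b ∈ T → Edge a b → col a b ≡ just d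
  coloured-edge {a = a} {b} coloured a∈S b∈T (x , e) = subst (λ x → col a b ≡ just x) (coloured a∈S b∈T e) e

  nonNeighboursᴬ : ∀ b → Below ε m ∣ ∁ (nbrB col b) ∣
  nonNeighboursᴬ b = Above⇒Below-complement (∣p∣+∣∁p∣≡n (nbrB col b)) (proj₁ deg b)

  nonNeighboursᴮ : ∀ a → Below ε n ∣ ∁ (nbrA col a) ∣
  nonNeighboursᴮ a = Above⇒Below-complement (∣p∣+∣∁p∣≡n (nbrA col a)) (proj₂ deg a)

  neighbour-inᴬ : ∀ b {S} → AtLeast ε m ∣ S ∣ → ∃ λ a → a ∈ S × Edge a b
  neighbour-inᴬ b S-large =
    let a , a∈S , a∈N = meets (nonNeighboursᴬ b) S-large in a , a∈S , ∈nbrB⇒Edge a∈N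

  neighbour-inᴮ : ∀ a {T} → AtLeast ε n ∣ T ∣ → ∃ λ b → b ∈ T × Edge a b
  neighbour-inᴮ a T-large =
    let b , b∈T , b∈N = meets (nonNeighboursᴮ a) T-large in b , b∈T , ∈nbrA⇒Edge b∈N

  common-neighbour-inᴬ : ∀ b₁ b₂ {S} → AtLeast (ε + ε) m ∣ S ∣ → ∃ λ a → a ∈ S × Edge a b₁ × Edge a b₂
  common-neighbour-inᴬ b₁ b₂ S-large =
    let a , a∈S , a∈N₁ , a∈N₂ = meets₂ (nonNeighboursᴬ b₁) (nonNeighboursᴬ b₂) S-large
    in a , a∈S , ∈nbrB⇒Edge a∈N₁ , ∈nbrB⇒Edge a∈N₂

  absorbsᴬ : ∀ {d q S T} → ColouredBetween d S T → AtLeast ε n ∣ T ∣ → T ⊆ Yof d q → S ⊆ Xof d q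
  absorbsᴬ {d} {q} coloured T-large T⊆ {a} a∈S =
    let b , b∈T , e = neighbour-inᴮ a T-large
    in ∈component⁺ d q {inj₁ a} (∈component⁻ d q {inj₂ b} (T⊆ b∈T) ◅◅ Conn-sym (edge (coloured-edge coloured a∈S b∈T e)))

  absorbsᴮ : ∀ {d q S T} → ColouredBetween d S T → AtLeast ε m ∣ S ∣ → S ⊆ Xof d q → T ⊆ Yof d q
  absorbsᴮ {d} {q} coloured S-large S⊆ {b} b∈T =
    let a , a∈S , e = neighbour-inᴬ b S-large
    in ∈component⁺ d q {inj₂ b} (∈component⁻ d q {inj₁ a} (S⊆ a∈S) ◅◅ edge (coloured-edge coloured a∈S b∈T e))

  crossing : ∀ {d S T b₀} → ColouredBetween d S T → AtLeast (ε + ε) m ∣ S ∣ → AtLeast ε n ∣ T ∣ →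
             b₀ ∈ T → (S , T) ⊆ᵥ component d (inj₂ b₀)
  crossing {d} {S} {T} {b₀} coloured S-large T-large b₀∈T = absorbsᴬ coloured T-large T⊆ , T⊆
    where
    T⊆ : T ⊆ Yof d (inj₂ b₀)
    T⊆ {b} b∈T =
      let a , a∈S , e₀ , e = common-neighbour-inᴬ b₀ b S-large
      in ∈component⁺ d (inj₂ b₀) {inj₂ b}
           (Conn-sym (edge (coloured-edge coloured a∈S b₀∈T e₀)) ◅◅ edge (coloured-edge coloured a∈S b∈T e))

module _ {m n} (col : Coloured m n) where

  open Components col

  SplitColour : ℚ → Colour → Set
  SplitColour γ c = (∀ X Y → IsComp col c X Y → NonTrivial γ X Y) × ExactlyTwoComps col c

  splitColour : ∀ {γ c v₁ v₂} → (∀ w → Conn col c v₁ w ⊎ Conn col c v₂ w) → ¬ Conn col c v₁ v₂ →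
                Large γ (component c v₁) → Large γ (component c v₂) → SplitColour γ c
  splitColour {γ} cover v₁≁v₂ K₁-large K₂-large =
    (λ X Y isComp → Large⇒NonTrivial {K = X , Y} ([ large K₁-large , large K₂-large ]′ (components-covered cover isComp))) ,
    exactlyTwoComps cover v₁≁v₂
    where
    large : ∀ {K L : VertexSet m n} → Large γ L → K ≡ L → Large γ K
    large L-large K≡L = subst (Large γ) (sym K≡L) L-large

  Split-∀ : ∀ {γ} → (∀ c → SplitColour γ c) → Split γ col
  Split-∀ split = (λ c → proj₁ (split c)) , (λ c → proj₂ (split c))

module Corollary {m n} (col : Coloured m n) (ε : ℚ) (0<ε : 0ℚ < ε) (ε<1/6 : ε < + 1 / 6)
                 (deg : CompleteDegree (1ℚ - ε) col) (a₀ : Fin m) where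

  open Components col
  open Dense col ε deg
  open SmallParameter ε 0<ε ε<1/6

  -- The B-sides of the two components of a₀ cover its neighbourhood, which misses fewer than
  -- ε n vertices; as 2ε + 2ε + ε ≤ 1, one of them has at least 2ε n vertices.
  some-colour-large : ∃ λ c → AtLeast 2ε n ∣ Yof c (inj₁ a₀) ∣
  some-colour-large = choose (atLeast⊎below 2ε n ∣ Y₀ ∣) (atLeast⊎below 2ε n ∣ Y₁ ∣)
    where
    Γ : Subset n
    Γ = nbrA col a₀
    Y₀ Y₁ : Subset n
    Y₀ = Yof zero (inj₁ a₀)
    Y₁ = Yof (suc zero) (inj₁ a₀)
    Γ⊆Y₀∪Y₁ : Γ ⊆ Y₀ ∪ Y₁
    Γ⊆Y₀∪Y₁ {b} b∈Γ with ∈nbrA⇒Edge b∈Γ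
    ... | zero     , e = p⊆p∪q Y₁ (∈component⁺ zero (inj₁ a₀) {inj₂ b} (edge e))
    ... | suc zero , e = q⊆p∪q Y₀ Y₁ (∈component⁺ (suc zero) (inj₁ a₀) {inj₂ b} (edge e))
    n≤ : n ℕ.≤ ∣ Y₀ ∣ ℕ.+ ∣ Y₁ ∣ ℕ.+ ∣ ∁ Γ ∣
    n≤ = ℕₚ.≤-trans (ℕₚ.≤-reflexive (sym (∣p∣+∣∁p∣≡n Γ)))
           (ℕₚ.+-monoˡ-≤ ∣ ∁ Γ ∣ (ℕₚ.≤-trans (p⊆q⇒∣p∣≤∣q∣ Γ⊆Y₀∪Y₁) (∣p∪q∣≤∣p∣+∣q∣ Y₀ Y₁)))
    choose : AtLeast 2ε n ∣ Y₀ ∣ ⊎ Below 2ε n ∣ Y₀ ∣ → AtLeast 2ε n ∣ Y₁ ∣ ⊎ Below 2ε n ∣ Y₁ ∣ →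
             ∃ λ c → AtLeast 2ε n ∣ Yof c (inj₁ a₀) ∣
    choose (inj₁ Y₀-large) _               = zero , Y₀-large
    choose (inj₂ _)        (inj₁ Y₁-large) = suc zero , Y₁-large
    choose (inj₂ Y₀-small) (inj₂ Y₁-small) = ⊥-elim (ℕₚ.<⇒≱
      (Below-AtLeast⇒< (Below-+ (Below-+ Y₀-small Y₁-small) (nonNeighboursᴮ a₀)) (AtLeast-all 2ε+2ε+ε≤1)) n≤)

  crossing-component : ∀ {d S T} → ColouredBetween d S T → AtLeast 2ε m ∣ S ∣ → AtLeast ε n ∣ T ∣ →
                       ∃ λ b → (S , T) ⊆ᵥ component d (inj₂ b)
  crossing-component coloured S-large T-large =
    let b , b∈T , _ = neighbour-inᴮ a₀ T-large
    in b , crossing coloured (AtLeast-antitone ε+ε≤2ε S-large) T-large b∈T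

  ∁ᴬ-component : ∀ {c v} → AtLeast 2ε m ∣ ∁ (Xof c v) ∣ → AtLeast ε n ∣ Yof c v ∣ →
                 ∃ λ b → (∁ (Xof c v) , Yof c v) ⊆ᵥ component (other c) (inj₂ b)
  ∁ᴬ-component = crossing-component leavingᴬ-coloured

  ∁ᴮ-component : ∀ {c v} → AtLeast 2ε m ∣ Xof c v ∣ → AtLeast ε n ∣ ∁ (Yof c v) ∣ →
                 ∃ λ b → (Xof c v , ∁ (Yof c v)) ⊆ᵥ component (other c) (inj₂ b)
  ∁ᴮ-component = crossing-component leavingᴮ-coloured

  2ε-large-component : ∃₂ λ c v → Large 2ε (component c v)
  2ε-large-component =
    let c , Y-large = some-colour-large in by-cases Y-large (atLeast⊎below 2ε m ∣ Xof c (inj₁ a₀) ∣)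
    where
    by-cases : ∀ {c} → AtLeast 2ε n ∣ Yof c (inj₁ a₀) ∣ →
               AtLeast 2ε m ∣ Xof c (inj₁ a₀) ∣ ⊎ Below 2ε m ∣ Xof c (inj₁ a₀) ∣ → ∃₂ λ d u → Large 2ε (component d u)
    by-cases {c} Y-large (inj₁ X-large) = c , inj₁ a₀ , X-large , Y-large
    by-cases {c} Y-large (inj₂ X-small) =
      let ∁X-large = ∁-large 2ε≤1-2ε (Xof c (inj₁ a₀)) X-small
          b , D⊇ = ∁ᴬ-component ∁X-large (AtLeast-antitone ε≤2ε Y-large)
      in other c , inj₂ b , Large-mono D⊇ (∁X-large , Y-large)

  spans : {p r s : Subset k} → p ⊆ s → Below 3ε k ∣ ∁ p ∣ ⊎ ∁ p ⊆ r → r ⊆ s → AtLeast (1ℚ - 3ε) k ∣ s ∣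
  spans {p = p} p⊆s (inj₁ ∁p-small) _   = AtLeast-mono (p⊆q⇒∣p∣≤∣q∣ p⊆s) (∁-small⇒large p ∁p-small)
  spans         p⊆s (inj₂ ∁p⊆r)     r⊆s =
    subst (AtLeast _ _) (sym (p⊆r∧∁p⊆r⇒∣r∣≡n p⊆s (⊆-trans ∁p⊆r r⊆s))) (AtLeast-all 1-3ε≤1)

  partnerᴬ : ∀ {c v} → Large 2ε (component c v) →
             ∃₂ λ d u → Large 2ε (component d u) × Yof c v ⊆ Yof d u ×
                        (Below 3ε m ∣ ∁ (Xof c v) ∣ ⊎ ∁ (Xof c v) ⊆ Xof d u)
  partnerᴬ {c} {v} (X-large , Y-large) with atLeast⊎below 3ε m ∣ ∁ (Xof c v) ∣
  ... | inj₂ ∁X-small = c , v , (X-large , Y-large) , (λ y∈ → y∈) , inj₁ ∁X-small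
  ... | inj₁ ∁X-large =
    let ∁X-large₂ = AtLeast-antitone 2ε≤3ε ∁X-large
        b , D⊇ = ∁ᴬ-component ∁X-large₂ (AtLeast-antitone ε≤2ε Y-large)
    in other c , inj₂ b , Large-mono D⊇ (∁X-large₂ , Y-large) , proj₂ D⊇ , inj₂ (proj₁ D⊇)

  partnerᴮ : ∀ {c v} → Large 2ε (component c v) →
             ∃₂ λ d u → Large 2ε (component d u) × Xof c v ⊆ Xof d u ×
                        (Below 3ε n ∣ ∁ (Yof c v) ∣ ⊎ ∁ (Yof c v) ⊆ Yof d u)
  partnerᴮ {c} {v} (X-large , Y-large) with atLeast⊎below 3ε n ∣ ∁ (Yof c v) ∣
  ... | inj₂ ∁Y-small = c , v , (X-large , Y-large) , (λ x∈ → x∈) , inj₁ ∁Y-small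
  ... | inj₁ ∁Y-large =
    let b , E⊇ = ∁ᴮ-component X-large (AtLeast-antitone ε≤3ε ∁Y-large)
    in other c , inj₂ b , Large-mono E⊇ (X-large , AtLeast-antitone 2ε≤3ε ∁Y-large) , proj₁ E⊇ , inj₂ (proj₂ E⊇)

  spanning-pair : Σ Colour λ c₁ → Σ (Subset m) λ X₁ → Σ (Subset n) λ Y₁ →
                  Σ Colour λ c₂ → Σ (Subset m) λ X₂ → Σ (Subset n) λ Y₂ →
                    IsComp col c₁ X₁ Y₁ × IsComp col c₂ X₂ Y₂ ×
                    NonTrivial 2ε X₁ Y₁ × NonTrivial 2ε X₂ Y₂ × NonTrivial (1ℚ - 3ε) (X₁ ∪ X₂) (Y₁ ∪ Y₂)
  spanning-pair =
    let c , v , K-large = 2ε-large-component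
        c₁ , v₁ , P-large , Y⊆P , ∁X-small-or-⊆P = partnerᴬ K-large
        c₂ , v₂ , Q-large , X⊆Q , ∁Y-small-or-⊆Q = partnerᴮ K-large
    in c₁ , Xof c₁ v₁ , Yof c₁ v₁ , c₂ , Xof c₂ v₂ , Yof c₂ v₂ , component-IsComp c₁ v₁ , component-IsComp c₂ v₂ ,
       Large⇒NonTrivial {K = component c₁ v₁} P-large , Large⇒NonTrivial {K = component c₂ v₂} Q-large ,
       Large⇒NonTrivial {K = component c₁ v₁ ∪ᵥ component c₂ v₂}
         ( spans (⊆-trans X⊆Q (q⊆p∪q (Xof c₁ v₁) (Xof c₂ v₂))) ∁X-small-or-⊆P (p⊆p∪q (Xof c₂ v₂))
         , spans (⊆-trans Y⊆P (p⊆p∪q (Yof c₂ v₂))) ∁Y-small-or-⊆Q (q⊆p∪q (Yof c₁ v₁) (Yof c₂ v₂)) )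

  -- ∁ X lies in the other-colour component D of Y, and ∁ Y in the component E of X.  If D and E
  -- are not connected, every edge between ∁ X ⊆ D and ∁ Y ⊆ E has colour c.
  ∁-component : ∀ {c v} → Large 2ε (component c v) → AtLeast 3ε m ∣ ∁ (Xof c v) ∣ → AtLeast 3ε n ∣ ∁ (Yof c v) ∣ →
                ∃₂ λ d u → (∁ (Xof c v) , ∁ (Yof c v)) ⊆ᵥ component d u
  ∁-component {c} {v} (X-large , Y-large) ∁X-large ∁Y-large = connected-or-not (Conn? (other c) (inj₂ b₁) (inj₂ b₂))
    where
    ∁X-large₂ : AtLeast 2ε m ∣ ∁ (Xof c v) ∣
    ∁X-large₂ = AtLeast-antitone 2ε≤3ε ∁X-large
    ∁Y-large₁ : AtLeast ε n ∣ ∁ (Yof c v) ∣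
    ∁Y-large₁ = AtLeast-antitone ε≤3ε ∁Y-large
    D : ∃ λ b → (∁ (Xof c v) , Yof c v) ⊆ᵥ component (other c) (inj₂ b)
    D = ∁ᴬ-component ∁X-large₂ (AtLeast-antitone ε≤2ε Y-large)
    E : ∃ λ b → (Xof c v , ∁ (Yof c v)) ⊆ᵥ component (other c) (inj₂ b)
    E = ∁ᴮ-component X-large ∁Y-large₁
    b₁ b₂ : Fin n
    b₁ = proj₁ D
    b₂ = proj₁ E
    connected-or-not : Dec (Conn col (other c) (inj₂ b₁) (inj₂ b₂)) →
                       ∃₂ λ d u → (∁ (Xof c v) , ∁ (Yof c v)) ⊆ᵥ component d u
    connected-or-not (yes D~E) = other c , inj₂ b₁ , proj₁ (proj₂ D) , ⊆-trans (proj₂ (proj₂ E)) (proj₂ (component-⊆ D~E))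
    connected-or-not (no  D≁E) =
      let coloured = subst (λ d → ColouredBetween d (∁ (Xof c v)) (∁ (Yof c v))) (other-involutive c)
                           (ColouredBetween-mono (proj₁ (proj₂ D)) (proj₂ (proj₂ E)) (between-coloured D≁E))
          b , ∁⊆ = crossing-component coloured ∁X-large₂ ∁Y-large₁
      in c , inj₂ b , ∁⊆

  3ε-large-component : ∃₂ λ c v → Large 3ε (component c v)
  3ε-large-component =
    let c , v , K-large = 2ε-large-component
    in by-cases K-large (atLeast⊎below 3ε m ∣ Xof c v ∣) (atLeast⊎below 3ε n ∣ Yof c v ∣)
    where
    by-cases : ∀ {c v} → Large 2ε (component c v) →
               AtLeast 3ε m ∣ Xof c v ∣ ⊎ Below 3ε m ∣ Xof c v ∣ → AtLeast 3ε n ∣ Yof c v ∣ ⊎ Below 3ε n ∣ Yof c v ∣ →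
               ∃₂ λ d u → Large 3ε (component d u)
    by-cases {c} {v} _ (inj₁ X-large₃) (inj₁ Y-large₃) = c , v , X-large₃ , Y-large₃
    by-cases {c} {v} (_ , Y-large) (inj₂ X-small) (inj₁ Y-large₃) =
      let ∁X-large = ∁-large 3ε≤1-3ε (Xof c v) X-small
          b , D⊇ = ∁ᴬ-component (AtLeast-antitone 2ε≤3ε ∁X-large) (AtLeast-antitone ε≤2ε Y-large)
      in other c , inj₂ b , Large-mono {K = ∁ (Xof c v) , Yof c v} D⊇ (∁X-large , Y-large₃)
    by-cases {c} {v} (X-large , _) (inj₁ X-large₃) (inj₂ Y-small) =
      let ∁Y-large = ∁-large 3ε≤1-3ε (Yof c v) Y-small
          b , E⊇ = ∁ᴮ-component X-large (AtLeast-antitone ε≤3ε ∁Y-large)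
      in other c , inj₂ b , Large-mono {K = Xof c v , ∁ (Yof c v)} E⊇ (X-large₃ , ∁Y-large)
    by-cases {c} {v} K-large (inj₂ X-small) (inj₂ Y-small) =
      let ∁X-large = ∁-large 3ε≤1-3ε (Xof c v) X-small
          ∁Y-large = ∁-large 3ε≤1-3ε (Yof c v) Y-small
          d , u , ∁⊆ = ∁-component K-large ∁X-large ∁Y-large
      in d , u , Large-mono {K = ∁ (Xof c v) , ∁ (Yof c v)} ∁⊆ (∁X-large , ∁Y-large)

  module TwoLargeComponents {c v w} (Kv-large : Large 3ε (component c v)) (Kw-large : Large 3ε (component c w))
                            (v≁w : ¬ Conn col c v w) where

    c′ : Colour
    c′ = other c
    X X₂ : Subset m
    X  = Xof c v
    X₂ = Xof c w
    Y Y₂ : Subset n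
    Y  = Yof c v
    Y₂ = Yof c w

    X-large : AtLeast 3ε m ∣ X ∣
    X-large = proj₁ Kv-large
    Y-large : AtLeast 3ε n ∣ Y ∣
    Y-large = proj₂ Kv-large
    X₂-large : AtLeast 3ε m ∣ X₂ ∣
    X₂-large = proj₁ Kw-large
    Y₂-large : AtLeast 3ε n ∣ Y₂ ∣
    Y₂-large = proj₂ Kw-large

    K₁ : ∃ λ b → (X , Y₂) ⊆ᵥ component c′ (inj₂ b)
    K₁ = crossing-component (between-coloured v≁w) (AtLeast-antitone 2ε≤3ε X-large) (AtLeast-antitone ε≤3ε Y₂-large)
    K₂ : ∃ λ b → (X₂ , Y) ⊆ᵥ component c′ (inj₂ b)
    K₂ = crossing-component (between-coloured (v≁w ∘ Conn-sym)) (AtLeast-antitone 2ε≤3ε X₂-large)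
                            (AtLeast-antitone ε≤3ε Y-large)

    q₁ q₂ : Vertex m n
    q₁ = inj₂ (proj₁ K₁)
    q₂ = inj₂ (proj₁ K₂)

    X⊆₁ : X ⊆ Xof c′ q₁
    X⊆₁ = proj₁ (proj₂ K₁)
    Y₂⊆₁ : Y₂ ⊆ Yof c′ q₁
    Y₂⊆₁ = proj₂ (proj₂ K₁)
    X₂⊆₂ : X₂ ⊆ Xof c′ q₂
    X₂⊆₂ = proj₁ (proj₂ K₂)
    Y⊆₂ : Y ⊆ Yof c′ q₂
    Y⊆₂ = proj₂ (proj₂ K₂)

    ∁X⊆₂ : ∁ X ⊆ Xof c′ q₂
    ∁X⊆₂ = absorbsᴬ (leavingᴬ-coloured {c} {v}) (AtLeast-antitone ε≤3ε Y-large) Y⊆₂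
    ∁X₂⊆₁ : ∁ X₂ ⊆ Xof c′ q₁
    ∁X₂⊆₁ = absorbsᴬ (leavingᴬ-coloured {c} {w}) (AtLeast-antitone ε≤3ε Y₂-large) Y₂⊆₁
    ∁Y⊆₁ : ∁ Y ⊆ Yof c′ q₁
    ∁Y⊆₁ = absorbsᴮ (leavingᴮ-coloured {c} {v}) (AtLeast-antitone ε≤3ε X-large) X⊆₁
    ∁Y₂⊆₂ : ∁ Y₂ ⊆ Yof c′ q₂
    ∁Y₂⊆₂ = absorbsᴮ (leavingᴮ-coloured {c} {w}) (AtLeast-antitone ε≤3ε X₂-large) X₂⊆₂

    everything : Conn col c′ q₁ q₂ → ∀ u → Conn col c′ q₂ u
    everything q₁~q₂ (inj₁ a) =
      [ (λ a∈X → Conn-sym q₁~q₂ ◅◅ ∈component⁻ c′ q₁ (X⊆₁ a∈X)) , (λ a∈∁X → ∈component⁻ c′ q₂ (∁X⊆₂ a∈∁X)) ]′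
      (∈⊎∈∁ a X)
    everything q₁~q₂ (inj₂ b) =
      [ (λ b∈Y → ∈component⁻ c′ q₂ (Y⊆₂ b∈Y)) , (λ b∈∁Y → Conn-sym q₁~q₂ ◅◅ ∈component⁻ c′ q₁ (∁Y⊆₁ b∈∁Y)) ]′
      (∈⊎∈∁ b Y)

    connected : Conn col c′ q₁ q₂ → ∃ λ d → ExactlyOneNonTrivial 3ε col d
    connected q₁~q₂ =
      c′ , Xof c′ q₂ , Yof c′ q₂ , component-IsComp c′ q₂ ,
      Large⇒NonTrivial {K = component c′ q₂} (Large-mono {K = X₂ , Y} (X₂⊆₂ , Y⊆₂) (X₂-large , Y-large)) ,
      λ X′ Y′ isComp _ → unique-component (everything q₁~q₂) isComp

    module _ (q₁≁q₂ : ¬ Conn col c′ q₁ q₂) where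

      -- A vertex outside both c-components would join q₁ and q₂ in colour c′.
      cover : ∀ u → Conn col c v u ⊎ Conn col c w u
      cover (inj₁ a) = coverᴬ (∈⊎∈∁ a X) (∈⊎∈∁ a X₂)
        where
        coverᴬ : a ∈ X ⊎ a ∈ ∁ X → a ∈ X₂ ⊎ a ∈ ∁ X₂ → Conn col c v (inj₁ a) ⊎ Conn col c w (inj₁ a)
        coverᴬ (inj₁ a∈X)  _             = inj₁ (∈component⁻ c v a∈X)
        coverᴬ (inj₂ _)    (inj₁ a∈X₂)  = inj₂ (∈component⁻ c w a∈X₂)
        coverᴬ (inj₂ a∈∁X) (inj₂ a∈∁X₂) =
          ⊥-elim (q₁≁q₂ (∈component⁻ c′ q₁ {inj₁ a} (∁X₂⊆₁ a∈∁X₂) ◅◅ Conn-sym (∈component⁻ c′ q₂ (∁X⊆₂ a∈∁X))))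
      cover (inj₂ b) = coverᴮ (∈⊎∈∁ b Y) (∈⊎∈∁ b Y₂)
        where
        coverᴮ : b ∈ Y ⊎ b ∈ ∁ Y → b ∈ Y₂ ⊎ b ∈ ∁ Y₂ → Conn col c v (inj₂ b) ⊎ Conn col c w (inj₂ b)
        coverᴮ (inj₁ b∈Y)  _             = inj₁ (∈component⁻ c v b∈Y)
        coverᴮ (inj₂ _)    (inj₁ b∈Y₂)  = inj₂ (∈component⁻ c w b∈Y₂)
        coverᴮ (inj₂ b∈∁Y) (inj₂ b∈∁Y₂) =
          ⊥-elim (q₁≁q₂ (∈component⁻ c′ q₁ {inj₂ b} (∁Y⊆₁ b∈∁Y) ◅◅ Conn-sym (∈component⁻ c′ q₂ (∁Y₂⊆₂ b∈∁Y₂))))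

      cover′ : ∀ u → Conn col c′ q₁ u ⊎ Conn col c′ q₂ u
      cover′ (inj₁ a) =
        Sum.map (λ a∈X → ∈component⁻ c′ q₁ (X⊆₁ a∈X)) (λ a∈∁X → ∈component⁻ c′ q₂ (∁X⊆₂ a∈∁X)) (∈⊎∈∁ a X)
      cover′ (inj₂ b) =
        Sum.swap (Sum.map (λ b∈Y → ∈component⁻ c′ q₂ (Y⊆₂ b∈Y)) (λ b∈∁Y → ∈component⁻ c′ q₁ (∁Y⊆₁ b∈∁Y)) (∈⊎∈∁ b Y))

      separated : Split 2ε col
      separated = Split-∀ col {γ = 2ε} (∀-colour c
        (splitColour col cover v≁w (Large-antitone {K = component c v} 2ε≤3ε Kv-large)
                                   (Large-antitone {K = component c w} 2ε≤3ε Kw-large))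
        (splitColour col cover′ q₁≁q₂
          (Large-mono {K = X , Y₂} (proj₂ K₁) (AtLeast-antitone 2ε≤3ε X-large , AtLeast-antitone 2ε≤3ε Y₂-large))
          (Large-mono {K = X₂ , Y} (proj₂ K₂) (AtLeast-antitone 2ε≤3ε X₂-large , AtLeast-antitone 2ε≤3ε Y-large))))

    split-or-unique : Split 2ε col ⊎ ∃ λ d → ExactlyOneNonTrivial 3ε col d
    split-or-unique = [ inj₂ ∘ connected , inj₁ ∘ separated ]′ (toSum (Conn? c′ q₁ q₂))

  split-or-unique : ∀ {c v} → Large 3ε (component c v) → Split 2ε col ⊎ ∃ λ d → ExactlyOneNonTrivial 3ε col d
  split-or-unique {c} {v} Kv-large = decide (∃-vertex? (λ w → Large? 3ε (component c w) ×-dec ¬? (Conn? c v w)))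
    where
    decide : Dec (∃ λ w → Large 3ε (component c w) × ¬ Conn col c v w) →
             Split 2ε col ⊎ ∃ λ d → ExactlyOneNonTrivial 3ε col d
    decide (yes (w , Kw-large , v≁w)) = TwoLargeComponents.split-or-unique Kv-large Kw-large v≁w
    decide (no  no-other) =
      inj₂ (c , Xof c v , Yof c v , component-IsComp c v , Large⇒NonTrivial {K = component c v} Kv-large , unique)
      where
      unique : ∀ X Y → IsComp col c X Y → NonTrivial 3ε X Y → (X , Y) ≡ (Xof c v , Yof c v)
      unique X Y isComp XY-large =
        let w , XY≡ = IsComp⇒component isComp
            Kw-large = subst (Large 3ε) XY≡ (NonTrivial⇒Large {X = X} {Y} XY-large)
        in trans XY≡ (sym (component-cong (decidable-stable (Conn? c v w) (λ v≁w → no-other (w , Kw-large , v≁w)))))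

  unique-unless-split : ¬ Split 2ε col → ∃ λ c → ExactlyOneNonTrivial 3ε col c
  unique-unless-split ¬split =
    let c , v , K-large = 3ε-large-component in [ ⊥-elim ∘ ¬split , id ]′ (split-or-unique K-large)

corollary15 : (m n : ℕ) → 0 Data.Nat.< m → (ε : ℚ) → 0ℚ < ε → ε < + 1 / 6 →
    (col : Coloured m n) → CompleteDegree (1ℚ - ε) col →
    (Σ Colour λ c₁ → Σ (Subset m) λ X₁ → Σ (Subset n) λ Y₁ →
     Σ Colour λ c₂ → Σ (Subset m) λ X₂ → Σ (Subset n) λ Y₂ →
       IsComp col c₁ X₁ Y₁ × IsComp col c₂ X₂ Y₂ ×
       NonTrivial (+ 2 / 1 * ε) X₁ Y₁ × NonTrivial (+ 2 / 1 * ε) X₂ Y₂ ×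
       NonTrivial (1ℚ - + 3 / 1 * ε) (X₁ ∪ X₂) (Y₁ ∪ Y₂))
    × (¬ Split (+ 2 / 1 * ε) col → ∃ λ c → ExactlyOneNonTrivial (+ 3 / 1 * ε) col c)
corollary15 m n 0<m ε 0<ε ε<1/6 col deg = spanning-pair , unique-unless-split
  where open Corollary col ε 0<ε ε<1/6 deg (fromℕ< 0<m)
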